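{- Assume that $\mathcal{A} = (Q,q_0,\delta,F)$ is a linear weak alternating automaton (LWAA). Then $\mathcal{L}(\mathcal{A}) \neq \emptyset$ if and only if there exists a finite run dag $\Delta = e_0 e_1 \ldots e_n$ with configurations $c_0 c_1 \ldots c_{n+1}$ over a finite sequence $s_0 \ldots s_n$ of states and some $k \leq n$ such that (1) $c_k = c_{n+1}$, and (2) for every $q \in F$, one has $(q,q) \notin e_j$ for some $j$ where $k \leq j \leq n$.
   Context: Fix a finite set $\mathcal{V}$ of atomic propositions; a state is a subset $s \subseteq \mathcal{V}$, and a temporal structure is a sequence $\sigma = s_0 s_1 \ldots$ of states. A set is identified with the Boolean valuation making true exactly its elements. An alternating $\omega$-automaton $\mathcal{A} = (Q, q_0, \delta, Acc)$ has a finite set of locations $Q$ with $Q \cap \mathcal{V} = \emptyset$, an initial location $q_0 \in Q$, a transition function $\delta$ assigning to each $q \in Q$ a propositional formula $\delta(q)$ over $Q \cup \mathcal{V}$ in which locations occur only positively, and an acceptance condition $Acc \subseteq Q^{\omega}$. Write $q \rightarrow q'$ if $q'$ appears in $\delta(q)$. For a relation $r$, $\mathrm{dom}(r)$ is its domain and $r(A)$ the image of $A$ (with $r(x) = r(\{x\})$). A run dag of $\mathcal{A}$ over $\sigma = s_0 s_1 \ldots$ is a sequence $\Delta = e_0 e_1 \ldots$ of edge sets $e_i \subseteq Q \times Q$, with configurations $c_0 = \{q_0\}$ and $c_{i+1} = e_i(c_i)$, such that for all $i$, $\mathrm{dom}(e_i) \subseteq c_i$ and for all $q \in c_i$ the valuation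 $s_i \cup e_i(q)$ satisfies $\delta(q)$; a finite run dag is a finite prefix of a run dag. A path is a sequence $p_0 p_1 \ldots$ with $p_0 = q_0$ and $(p_i,p_{i+1}) \in e_i$. A run dag is accepting iff every infinite path lies in $Acc$, and $\mathcal{L}(\mathcal{A})$ is the set of temporal structures admitting an accepting run dag. A (co-Büchi) linear weak alternating automaton (LWAA) $\mathcal{A} = (Q,q_0,\delta,F)$ is such an automaton with $F \subseteq Q$, where the relation $q' \preceq_{\mathcal{A}} q$ iff $q \rightarrow^* q'$ is a partial order on $Q$, and $Acc$ is the set of sequences $p_0 p_1 \ldots \in Q^{\omega}$ with $p_i \in F$ for only finitely many $i$. -}

module Defs where

open import Data.Nat using (ℕ; zero; suc; _≤_)
open import Data.Fin using (Fin; _≟_)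
open import Data.Bool using (Bool; true; false; _∧_; _∨_)
open import Data.Product using (Σ; ∃; _×_; _,_)
open import Data.Empty using (⊥)
open import Data.Unit using (⊤)
open import Relation.Nullary using (¬_)
open import Relation.Nullary.Decidable using (⌊_⌋)
open import Relation.Binary.PropositionalEquality using (_≡_)
open import Relation.Binary.Structures using (IsPartialOrder)
open import Relation.Binary.Construct.Closure.ReflexiveTransitive using (Star)
open import Relation.Unary using (Pred)
open import Level using (0ℓ)

-- Atomic propositions 𝒱 = Fin m, locations Q = Fin n (disjoint types,
-- so Q ∩ 𝒱 = ∅).  A subset of a finite set X is a Boolean function
-- X → Bool (the set is identified with the valuation that makes true
-- exactly its elements); x ∈ S  means  S x ≡ true.

SetOf : ℕ → Set
SetOf k = Fin k → Bool

State : ℕ → Set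
State m = SetOf m

Word : ℕ → Set
Word m = ℕ → State m

-- Propositional formulas over Q ∪ 𝒱 in which locations occur only
-- positively (negation normal form, negation only on propositions).

data Formula (m n : ℕ) : Set where
  tt ff : Formula m n
  prop  : Fin m → Formula m n
  nprop : Fin m → Formula m n
  loc   : Fin n → Formula m n
  _∧ᶠ_ _∨ᶠ_ : Formula m n → Formula m n → Formula m n

-- Satisfaction by the valuation  s ∪ S  (s ⊆ 𝒱, S ⊆ Q).
Sat : ∀ {m n} → State m → SetOf n → Formula m n → Set
Sat s S tt        = ⊤
Sat s S ff        = ⊥
Sat s S (prop v)  = s v ≡ true
Sat s S (nprop v) = s v ≡ false
Sat s S (loc q)   = S q ≡ true
Sat s S (φ ∧ᶠ ψ)  = Sat s S φ × Sat s S ψ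
Sat s S (φ ∨ᶠ ψ)  = Sat s S φ ⊎' Sat s S ψ
  where open import Data.Sum renaming (_⊎_ to _⊎'_)

data Occurs {m n : ℕ} (q : Fin n) : Formula m n → Set where
  here : Occurs q (loc q)
  ∧ˡ : ∀ {φ ψ} → Occurs q φ → Occurs q (φ ∧ᶠ ψ)
  ∧ʳ : ∀ {φ ψ} → Occurs q ψ → Occurs q (φ ∧ᶠ ψ)
  ∨ˡ : ∀ {φ ψ} → Occurs q φ → Occurs q (φ ∨ᶠ ψ)
  ∨ʳ : ∀ {φ ψ} → Occurs q ψ → Occurs q (φ ∨ᶠ ψ)

record Automaton (m n : ℕ) : Set where
  field
    q₀ : Fin n
    δ  : Fin n → Formula m n

  _⟶_ : Fin n → Fin n → Set
  q ⟶ q' = Occurs q' (δ q)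

  _≼_ : Fin n → Fin n → Set
  q' ≼ q = Star _⟶_ q q'

record LWAA (m n : ℕ) : Set where
  field
    aut : Automaton m n
    F   : SetOf n
    linear-weak : IsPartialOrder _≡_ (Automaton._≼_ aut)
  open Automaton aut public

-- an edge set e ⊆ Q × Q ;  (q , q') ∈ e  iff  e q q' ≡ true ;
-- e q is the image e(q)
Edges : ℕ → Set
Edges n = Fin n → Fin n → Bool

anyFin : ∀ {n} → (Fin n → Bool) → Bool
anyFin {zero}  f = false
anyFin {suc n} f = f Fin.zero ∨ anyFin (λ i → f (Fin.suc i))
  where import Data.Fin as Fin

img : ∀ {n} → Edges n → SetOf n → SetOf n
img e c q' = anyFin (λ q → c q ∧ e q q')

config : ∀ {n} → Fin n → (ℕ → Edges n) → ℕ → SetOf n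
config q₀ Δ zero    q = ⌊ q ≟ q₀ ⌋
config q₀ Δ (suc i) = img (Δ i) (config q₀ Δ i)

module _ {m n : ℕ} (𝒜 : Automaton m n) where
  open Automaton 𝒜

  IsRunDag : Word m → (ℕ → Edges n) → Set
  IsRunDag σ Δ = ∀ i →
      (∀ q q' → Δ i q q' ≡ true → config q₀ Δ i q ≡ true)
    × (∀ q → config q₀ Δ i q ≡ true → Sat (σ i) (Δ i q) (δ q))

  IsPath : (ℕ → Edges n) → (ℕ → Fin n) → Set
  IsPath Δ p = (p zero ≡ q₀) × (∀ i → Δ i (p i) (p (suc i)) ≡ true)

  IsAccepting : Pred (ℕ → Fin n) 0ℓ → (ℕ → Edges n) → Set
  IsAccepting Acc Δ = ∀ p → IsPath Δ p → Acc p

  Language : Pred (ℕ → Fin n) 0ℓ → Pred (Word m) 0ℓ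
  Language Acc σ = Σ (ℕ → Edges n) λ Δ → IsRunDag σ Δ × IsAccepting Acc Δ

  -- finite run dag e₀ … e_N over s₀ … s_N : a finite prefix of a run dag.
  -- (s and e are given as ℕ-indexed sequences; only indices ≤ N matter.)
  IsFiniteRunDag : ℕ → Word m → (ℕ → Edges n) → Set
  IsFiniteRunDag N s e =
    Σ (Word m) λ σ → Σ (ℕ → Edges n) λ Δ → IsRunDag σ Δ ×
      (∀ i → i ≤ N → (σ i ≡ s i) × (Δ i ≡ e i))

InfinitelyMany : (ℕ → Set) → Set
InfinitelyMany P = ∀ N → ∃ λ i → N ≤ i × P i

FinitelyMany : (ℕ → Set) → Set
FinitelyMany P = ¬ InfinitelyMany P

coBüchi : ∀ {n} → SetOf n → Pred (ℕ → Fin n) 0ℓ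
coBüchi F p = FinitelyMany (λ i → F (p i) ≡ true)

ℒ : ∀ {m n} → LWAA m n → Pred (Word m) 0ℓ
ℒ 𝒜 = Language (LWAA.aut 𝒜) (coBüchi (LWAA.F 𝒜))

-- Call lasso a finite run dag prefix whose configuration after the last move equals an earlier
-- one, the loop between them missing the self-loop (q, q) of every q ∈ F at least once.
--
-- Unrolling a lasso gives a run dag in which every q ∈ F misses its self-loop infinitely often.
-- After pruning the edges that do not follow δ, every path descends in the partial order ≼; a path
-- visiting F infinitely often would then leave its location infinitely often, descending forever in
-- a finite order.  Conversely, in an accepting run dag every q ∈ F misses its self-loop infinitely
-- often, since otherwise a path reaching q could stay there; so there are consecutive windows each
-- containing a miss of every q ∈ F, and two of 2^|Q| + 1 window borders carry the same configuration.
-- As non-emptiness is only given negatively, this yields a lasso up to double negation; but having a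
-- lasso is decidable, being reachability in finite transition systems over configurations, hence
-- stable.

module Submission where

open import Defs
open import Level using (0ℓ)
open import Function using (id; _∘_; _⇔_; mk⇔; Equivalence)
open import Data.Nat
  using (ℕ; zero; suc; _≟_; _+_; _∸_; _^_; _*_; _⊔_; _≤_; _<_; _≤′_; ≤′-refl; ≤′-step; z≤n; s≤s; z<s; s<s; _<?_; _≤?_)
open import Data.Nat.Properties
open import Data.Nat.Induction using (<-wellFounded)
import Data.Fin as Fin
open import Data.Fin using (Fin; toℕ; combine; remQuot)
open import Data.Fin.Properties using (any?; all?; remQuot-combine; toℕ≤pred[n])
import Data.Fin.Properties as Finₚ
open import Data.Bool using (Bool; true; false; _∧_; _∨_; not)
open import Data.Bool.Properties using (T-≡; ¬-not; ∨-zeroʳ; ∧-conicalˡ; ∧-conicalʳ) renaming (_≟_ to _≟ᵇ_)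
open import Data.Product using (Σ; ∃; ∃₂; _×_; _,_; proj₁; proj₂)
open import Data.Sum using (_⊎_; inj₁; inj₂; [_,_])
open import Data.Empty using (⊥)
open import Data.Unit using (tt)
open import Data.Vec.Functional.Relation.Binary.Pointwise.Properties
  using () renaming (setoid to vector-setoid)
open import Data.Product.Relation.Binary.Pointwise.NonDependent using (_×ₛ_)
open import Induction.WellFounded using (Acc; acc)
open import Relation.Nullary using (¬_; Dec; yes; no; contradiction)
open import Relation.Nullary.Negation using (¬¬-Monad; ¬¬-map)
open import Effect.Monad using (RawMonad)
open import Relation.Nullary.Decidable
  using (⌊_⌋; toWitness; fromWitness; map′; _×-dec_; _⊎-dec_; _→-dec_; decidable-stable)
open import Relation.Binary using (Setoid; Rel; _Respects_; IsPartialOrder)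
open import Relation.Binary.PropositionalEquality as ≡
  using (_≡_; _≢_; _≗_; refl; cong; cong₂; cong-app; subst; subst₂)
open import Relation.Unary using (Pred; Decidable; ∅; _≐_)
open import Relation.Binary.Construct.Closure.ReflexiveTransitive using (Star; ε; _◅_; _◅◅_)

-- Finite setoids

record Finite (S : Setoid 0ℓ 0ℓ) : Set where
  open Setoid S
  field
    size          : ℕ
    encode        : Carrier → Fin size
    decode        : Fin size → Carrier
    decode-encode : ∀ a → decode (encode a) ≈ a

  encode-injective : ∀ {a b} → encode a ≡ encode b → a ≈ b
  encode-injective {a} {b} eq =
    trans (sym (decode-encode a)) (subst (λ c → decode c ≈ b) (≡.sym eq) (decode-encode b))

  search : {P : Pred Carrier 0ℓ} → P Respects _≈_ → Decidable P → Dec (∃ P)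
  search resp P? = map′ (λ (c , p) → decode c , p)
                        (λ (a , p) → encode a , resp (sym (decode-encode a)) p)
                        (any? (P? ∘ decode))

  pigeonhole : ∀ {n} → size < n → (f : Fin n → Carrier) → ∃₂ λ i j → i Fin.< j × f i ≈ f j
  pigeonhole size<n f with i , j , i<j , eq ← Finₚ.pigeonhole size<n (encode ∘ f) =
    i , j , i<j , encode-injective eq

Bool-finite : Finite (≡.setoid Bool)
Bool-finite = record { size = 2 ; encode = encode ; decode = decode ; decode-encode = decode-encode }
  where
  encode : Bool → Fin 2
  encode false = Fin.zero
  encode true  = Fin.suc Fin.zero
  decode : Fin 2 → Bool
  decode Fin.zero    = false
  decode (Fin.suc _) = true
  decode-encode : ∀ b → decode (encode b) ≡ b
  decode-encode false = refl
  decode-encode true  = refl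

Vector-finite : ∀ {S} → Finite S → ∀ k → Finite (vector-setoid S k)
Vector-finite {S} A k = record
  { size = size ^ k ; encode = encodeᵛ k ; decode = decodeᵛ k ; decode-encode = decode-encodeᵛ k }
  where
  open Finite A
  open Setoid S using (_≈_)
  encodeᵛ : ∀ k → (Fin k → Setoid.Carrier S) → Fin (size ^ k)
  encodeᵛ zero    f = Fin.zero
  encodeᵛ (suc k) f = combine (encode (f Fin.zero)) (encodeᵛ k (f ∘ Fin.suc))
  decodeᵛ : ∀ k → Fin (size ^ k) → Fin k → Setoid.Carrier S
  decodeᵛ (suc k) c Fin.zero    = decode (proj₁ (remQuot {size} (size ^ k) c))
  decodeᵛ (suc k) c (Fin.suc i) = decodeᵛ k (proj₂ (remQuot {size} (size ^ k) c)) i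
  decode-encodeᵛ : ∀ k f i → decodeᵛ k (encodeᵛ k f) i ≈ f i
  decode-encodeᵛ (suc k) f i = split i
    where
    split-combine : remQuot {size} (size ^ k) (encodeᵛ (suc k) f) ≡ (encode (f Fin.zero) , encodeᵛ k (f ∘ Fin.suc))
    split-combine = remQuot-combine {size} {size ^ k} (encode (f Fin.zero)) (encodeᵛ k (f ∘ Fin.suc))
    split : ∀ i → decodeᵛ (suc k) (encodeᵛ (suc k) f) i ≈ f i
    split Fin.zero    = subst (λ p → decode (proj₁ p) ≈ f Fin.zero) (≡.sym split-combine)
                              (decode-encode (f Fin.zero))
    split (Fin.suc i) = subst (λ p → decodeᵛ k (proj₂ p) i ≈ f (Fin.suc i)) (≡.sym split-combine)
                              (decode-encodeᵛ k (f ∘ Fin.suc) i)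

×-finite : ∀ {S T} → Finite S → Finite T → Finite (S ×ₛ T)
×-finite {S} {T} A B = record
  { size = A.size * B.size ; encode = encode ; decode = decode ; decode-encode = decode-encode }
  where
  module A = Finite A
  module B = Finite B
  open Setoid (S ×ₛ T) using (Carrier; _≈_)
  encode : Carrier → Fin (A.size * B.size)
  encode (a , b) = combine (A.encode a) (B.encode b)
  decode : Fin (A.size * B.size) → Carrier
  decode c = let (i , j) = remQuot {A.size} B.size c in A.decode i , B.decode j
  decode-encode : ∀ p → decode (encode p) ≈ p
  decode-encode (a , b) =
    subst (λ (i , j) → (A.decode i , B.decode j) ≈ (a , b))
          (≡.sym (remQuot-combine {A.size} {B.size} (A.encode a) (B.encode b)))
          (A.decode-encode a , B.decode-encode b)

-- Reachability in finite labelled transition systems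

iterate : ∀ {A X : Set} → (A → X → A) → A → (ℕ → X) → ℕ → A
iterate next a f zero    = a
iterate next a f (suc i) = iterate next (next a (f 0)) (f ∘ suc) i

iterate-suc : ∀ {A X : Set} (next : A → X → A) a f i →
              iterate next a f (suc i) ≡ next (iterate next a f i) (f i)
iterate-suc next a f zero    = refl
iterate-suc next a f (suc i) = iterate-suc next (next a (f 0)) (f ∘ suc) i

infixr 5 _◂_
_◂_ : ∀ {A : Set} → A → (ℕ → A) → ℕ → A
(x ◂ f) zero    = x
(x ◂ f) (suc i) = f i

module Reachability
  {V X : Setoid 0ℓ 0ℓ} (V-finite : Finite V) (X-finite : Finite X)
  (Enabled : Setoid.Carrier V → Setoid.Carrier X → Set)
  (enabled? : ∀ a x → Dec (Enabled a x))
  (Enabled-resp : ∀ {a b x y} → Setoid._≈_ V a b → Setoid._≈_ X x y → Enabled a x → Enabled b y)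
  (next : Setoid.Carrier V → Setoid.Carrier X → Setoid.Carrier V)
  (next-cong : ∀ {a b x y} → Setoid._≈_ V a b → Setoid._≈_ X x y → Setoid._≈_ V (next a x) (next b y))
  (Target : Pred (Setoid.Carrier V) 0ℓ) (target? : Decidable Target)
  (Target-resp : Target Respects Setoid._≈_ V)
  where

  open Setoid V using (Carrier; _≈_; sym)
  open Setoid X using () renaming (Carrier to Label; _≈_ to _≈ₗ_; refl to reflₗ)
  open Finite V-finite using (size; pigeonhole)

  data Walk : ℕ → Carrier → Set where
    done : ∀ {a} → Target a → Walk 0 a
    step : ∀ {L a} x → Enabled a x → Walk L (next a x) → Walk (suc L) a

  Reachable : Pred Carrier 0ℓ
  Reachable a = ∃ λ L → Walk L a

  walk-resp : ∀ {L a b} → a ≈ b → Walk L a → Walk L b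
  walk-resp a≈b (done t)      = done (Target-resp a≈b t)
  walk-resp a≈b (step x en w) = step x (Enabled-resp a≈b reflₗ en) (walk-resp (next-cong a≈b reflₗ) w)

  vertex : ∀ {L a} → Walk L a → Fin (suc L) → Carrier
  vertex {a = a} _    Fin.zero    = a
  vertex (step _ _ w) (Fin.suc i) = vertex w i

  suffix : ∀ {L a} (w : Walk L a) (i : Fin (suc L)) → Walk (L ∸ toℕ i) (vertex w i)
  suffix w            Fin.zero    = w
  suffix (step _ _ w) (Fin.suc i) = suffix w i

  shortcut : ∀ {L a} (w : Walk L a) (i j : Fin (suc L)) → i Fin.< j → vertex w i ≈ vertex w j →
             ∃ λ L′ → L′ < L × Walk L′ a
  shortcut {L} w Fin.zero j i<j same =
    L ∸ toℕ j , ∸-monoʳ-< i<j (toℕ≤pred[n] j) , walk-resp (sym same) (suffix w j)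
  shortcut (step x en w) (Fin.suc i) (Fin.suc j) (s<s i<j) same
    with L′ , L′<L , w′ ← shortcut w i j i<j same = suc L′ , s<s L′<L , step x en w′

  shorten : ∀ {L a} → Acc _<_ L → Walk L a → ∃ λ L′ → L′ < size × Walk L′ a
  shorten {L} (acc smaller) w with L <? size
  ... | yes L<size = L , L<size , w
  ... | no  L≮size
    with i , j , i<j , same ← pigeonhole (s≤s (≮⇒≥ L≮size)) (vertex w)
    with L′ , L′<L , w′ ← shortcut w i j i<j same = shorten (smaller L′<L) w′

  Within : ℕ → Pred Carrier 0ℓ
  Within B a = ∃ λ L → L ≤ B × Walk L a

  within? : ∀ B → Decidable (Within B)
  within? zero a = map′ (λ t → 0 , z≤n , done t) (λ { (0 , _ , done t) → t }) (target? a)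
  within? (suc B) a =
    map′ (λ { (inj₁ t) → 0 , z≤n , done t
            ; (inj₂ (x , en , L , L≤B , w)) → suc L , s≤s L≤B , step x en w })
         (λ { (0 , _ , done t) → inj₁ t
            ; (suc L , s≤s L≤B , step x en w) → inj₂ (x , en , L , L≤B , w) })
         (target? a ⊎-dec Finite.search X-finite resp (λ x → enabled? a x ×-dec within? B (next a x)))
    where
    resp : (λ x → Enabled a x × Within B (next a x)) Respects _≈ₗ_
    resp x≈y (en , L , L≤B , w) =
      Enabled-resp (Setoid.refl V) x≈y en , L , L≤B , walk-resp (next-cong (Setoid.refl V) x≈y) w

  reachable? : Decidable Reachable
  reachable? a = map′ (λ (L , _ , w) → L , w) bound (within? size a)
    where
    bound : Reachable a → Within size a
    bound (L , w) with L′ , L′<size , w′ ← shorten (<-wellFounded L) w = L′ , <⇒≤ L′<size , w′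

  Trail : ℕ → Carrier → (ℕ → Label) → Set
  Trail L a f = (∀ i → i < L → Enabled (iterate next a f i) (f i)) × Target (iterate next a f L)

  trail⇒walk : ∀ L a f → Trail L a f → Walk L a
  trail⇒walk zero    a f (_ , t)  = done t
  trail⇒walk (suc L) a f (en , t) =
    step (f 0) (en 0 z<s) (trail⇒walk L (next a (f 0)) (f ∘ suc) ((λ i i<L → en (suc i) (s<s i<L)) , t))

  walk⇒trail : ∀ {L a} → Label → Walk L a → ∃ (Trail L a)
  walk⇒trail x₀ (done t) = (λ _ → x₀) , (λ _ ()) , t
  walk⇒trail x₀ (step x en w) with f , en′ , t ← walk⇒trail x₀ w =
    x ◂ f , (λ { zero _ → en ; (suc i) (s<s i<L) → en′ i i<L }) , t

Sat-mono : ∀ {m n} {s s′ : State m} {S S′ : SetOf n} φ → (∀ v → s v ≡ s′ v) →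
           (∀ q → Occurs q φ → S q ≡ true → S′ q ≡ true) → Sat s S φ → Sat s′ S′ φ
Sat-mono tt        s≡s′ S⊆S′ _           = tt
Sat-mono ff        s≡s′ S⊆S′ ()
Sat-mono (prop v)  s≡s′ S⊆S′ sat         = ≡.trans (≡.sym (s≡s′ v)) sat
Sat-mono (nprop v) s≡s′ S⊆S′ sat         = ≡.trans (≡.sym (s≡s′ v)) sat
Sat-mono (loc q)   s≡s′ S⊆S′ sat         = S⊆S′ q here sat
Sat-mono (φ ∧ᶠ ψ)  s≡s′ S⊆S′ (sφ , sψ)   =
  Sat-mono φ s≡s′ (λ q → S⊆S′ q ∘ ∧ˡ) sφ , Sat-mono ψ s≡s′ (λ q → S⊆S′ q ∘ ∧ʳ) sψ
Sat-mono (φ ∨ᶠ ψ)  s≡s′ S⊆S′ (inj₁ sφ)   = inj₁ (Sat-mono φ s≡s′ (λ q → S⊆S′ q ∘ ∨ˡ) sφ)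
Sat-mono (φ ∨ᶠ ψ)  s≡s′ S⊆S′ (inj₂ sψ)   = inj₂ (Sat-mono ψ s≡s′ (λ q → S⊆S′ q ∘ ∨ʳ) sψ)

sat? : ∀ {m n} (s : State m) (S : SetOf n) φ → Dec (Sat s S φ)
sat? s S tt        = yes tt
sat? s S ff        = no λ ()
sat? s S (prop v)  = s v ≟ᵇ true
sat? s S (nprop v) = s v ≟ᵇ false
sat? s S (loc q)   = S q ≟ᵇ true
sat? s S (φ ∧ᶠ ψ)  = sat? s S φ ×-dec sat? s S ψ
sat? s S (φ ∨ᶠ ψ)  = sat? s S φ ⊎-dec sat? s S ψ

occurs? : ∀ {m n} q (φ : Formula m n) → Dec (Occurs q φ)
occurs? q tt        = no λ ()
occurs? q ff        = no λ ()
occurs? q (prop v)  = no λ ()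
occurs? q (nprop v) = no λ ()
occurs? q (loc q′)  = map′ (λ { refl → here }) (λ { here → refl }) (q Fin.≟ q′)
occurs? q (φ ∧ᶠ ψ)  = map′ [ ∧ˡ , ∧ʳ ] (λ { (∧ˡ o) → inj₁ o ; (∧ʳ o) → inj₂ o })
                             (occurs? q φ ⊎-dec occurs? q ψ)
occurs? q (φ ∨ᶠ ψ)  = map′ [ ∨ˡ , ∨ʳ ] (λ { (∨ˡ o) → inj₁ o ; (∨ʳ o) → inj₂ o })
                             (occurs? q φ ⊎-dec occurs? q ψ)

∨-true⁻ : ∀ a b → a ∨ b ≡ true → a ≡ true ⊎ b ≡ true
∨-true⁻ true  b _ = inj₁ refl
∨-true⁻ false b h = inj₂ h

∨-∧-not-true : ∀ a b c → a ∨ (b ∧ not c) ≡ true ⇔ (a ≡ true ⊎ (b ≡ true × c ≡ false))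
∨-∧-not-true true  b     c     = mk⇔ (λ _ → inj₁ refl) (λ _ → refl)
∨-∧-not-true false false c     = mk⇔ (λ ()) λ { (inj₁ ()) ; (inj₂ (() , _)) }
∨-∧-not-true false true  false = mk⇔ (λ _ → inj₂ (refl , refl)) (λ _ → refl)
∨-∧-not-true false true  true  = mk⇔ (λ ()) λ { (inj₁ ()) ; (inj₂ (_ , ())) }

anyFin-cong : ∀ {n} {f g : Fin n → Bool} → f ≗ g → anyFin f ≡ anyFin g
anyFin-cong {zero}  f≗g = refl
anyFin-cong {suc n} f≗g = cong₂ _∨_ (f≗g Fin.zero) (anyFin-cong (f≗g ∘ Fin.suc))

anyFin⁻ : ∀ {n} (f : Fin n → Bool) → anyFin f ≡ true → ∃ λ i → f i ≡ true
anyFin⁻ {suc n} f h with ∨-true⁻ (f Fin.zero) _ h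
... | inj₁ f₀ = Fin.zero , f₀
... | inj₂ fₛ with i , fᵢ ← anyFin⁻ (f ∘ Fin.suc) fₛ = Fin.suc i , fᵢ

anyFin⁺ : ∀ {n} (f : Fin n → Bool) i → f i ≡ true → anyFin f ≡ true
anyFin⁺ f Fin.zero    fᵢ rewrite fᵢ = refl
anyFin⁺ f (Fin.suc i) fᵢ rewrite anyFin⁺ (f ∘ Fin.suc) i fᵢ = ∨-zeroʳ (f Fin.zero)

img-cong : ∀ {n} {e e′ : Edges n} {C C′ : SetOf n} →
           (∀ q q′ → e q q′ ≡ e′ q q′) → C ≗ C′ → img e C ≗ img e′ C′
img-cong e≡e′ C≗C′ q′ = anyFin-cong (λ q → cong₂ _∧_ (C≗C′ q) (e≡e′ q q′))

img⁻ : ∀ {n} (e : Edges n) C q′ → img e C q′ ≡ true → ∃ λ q → C q ≡ true × e q q′ ≡ true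
img⁻ e C q′ h with q , both ← anyFin⁻ _ h = q , ∧-conicalˡ (C q) (e q q′) both , ∧-conicalʳ (C q) (e q q′) both

img⁺ : ∀ {n} (e : Edges n) C {q q′} → C q ≡ true → e q q′ ≡ true → img e C q′ ≡ true
img⁺ e C {q} q∈C qq′∈e = anyFin⁺ _ q (cong₂ _∧_ q∈C qq′∈e)

no-infinite-descent : ∀ {n} {_≼_ : Rel (Fin n) 0ℓ} → IsPartialOrder _≡_ _≼_ → (a : ℕ → Fin n) →
                      ¬ (∀ r → a (suc r) ≼ a r × a (suc r) ≢ a r)
no-infinite-descent {n} {_≼_} po a desc
  with i , j , i<j , same ← Finₚ.pigeonhole (n<1+n n) (a ∘ toℕ) =
    proj₂ (desc (toℕ i))
          (antisym (proj₁ (desc (toℕ i))) (subst (_≼ a (suc (toℕ i))) (≡.sym same) (descends (≤⇒≤′ i<j))))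
  where
  open IsPartialOrder po using (antisym) renaming (refl to ≼-refl; trans to ≼-trans)
  descends : ∀ {r s} → r ≤′ s → a s ≼ a r
  descends ≤′-refl        = ≼-refl
  descends (≤′-step r≤′s) = ≼-trans (proj₁ (desc _)) (descends r≤′s)

¬¬-finite-bound : ∀ {n} (P : Fin n → ℕ → Set) → (∀ q → ¬ ¬ ∃ (P q)) →
                  ¬ ¬ ∃ λ b → ∀ q → ∃ λ j → j < b × P q j
¬¬-finite-bound {zero}  P eventually = contradiction (0 , λ ())
¬¬-finite-bound {suc n} P eventually = do
  (j , pⱼ) ← eventually Fin.zero
  (b , below-b) ← ¬¬-finite-bound (P ∘ Fin.suc) (eventually ∘ Fin.suc)
  pure (suc j ⊔ b , λ { Fin.zero → j , m≤m⊔n (suc j) b , pⱼ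
                      ; (Fin.suc q) → let (i , i<b , pᵢ) = below-b q in
                                      i , <-≤-trans i<b (m≤n⊔m (suc j) b) , pᵢ })
  where open RawMonad ¬¬-Monad

splice : ∀ {A : Set} → ℕ → (ℕ → A) → A → ℕ → A
splice k p a i with i ≤? k
... | yes _ = p i
... | no  _ = a

splice-≤ : ∀ {A : Set} {k i} (p : ℕ → A) a → i ≤ k → splice k p a i ≡ p i
splice-≤ {k = k} {i} p a i≤k with i ≤? k
... | yes _   = refl
... | no  i≰k = contradiction i≤k i≰k

splice-> : ∀ {A : Set} {k i} (p : ℕ → A) a → k < i → splice k p a i ≡ a
splice-> {k = k} {i} p a k<i with i ≤? k
... | yes i≤k = contradiction i≤k (<⇒≱ k<i)
... | no  _   = refl

-- Lassos

Sets : ℕ → Setoid 0ℓ 0ℓ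
Sets = vector-setoid (≡.setoid Bool)

Sets-finite : ∀ n → Finite (Sets n)
Sets-finite = Vector-finite Bool-finite

Move : ℕ → ℕ → Set
Move m n = State m × Edges n

Moves : ℕ → ℕ → Setoid 0ℓ 0ℓ
Moves m n = Sets m ×ₛ vector-setoid (Sets n) n

Moves-finite : ∀ m n → Finite (Moves m n)
Moves-finite m n = ×-finite (Sets-finite m) (Vector-finite (Sets-finite n) n)

module _ {m n} (𝒜 : LWAA m n) where
  open LWAA 𝒜

  step : SetOf n → Move m n → SetOf n
  step C (_ , e) = img e C

  step-cong : ∀ {C C′ x y} → C ≗ C′ → Setoid._≈_ (Moves m n) x y → step C x ≗ step C′ y
  step-cong C≗C′ (_ , e≗e′) = img-cong e≗e′ C≗C′

  configFrom : SetOf n → (ℕ → Move m n) → ℕ → SetOf n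
  configFrom = iterate step

  initial : SetOf n
  initial q = ⌊ q Fin.≟ q₀ ⌋

  config≡configFrom : ∀ f i → config q₀ (proj₂ ∘ f) i ≡ configFrom initial f i
  config≡configFrom f zero    = refl
  config≡configFrom f (suc i) = ≡.trans (cong (img (proj₂ (f i))) (config≡configFrom f i))
                                        (≡.sym (iterate-suc step initial f i))

  Enabled : SetOf n → Move m n → Set
  Enabled C (s , e) =
    (∀ q q′ → e q q′ ≡ true → C q ≡ true) × (∀ q → C q ≡ true → Sat s (e q) (δ q))

  enabled? : ∀ C x → Dec (Enabled C x)
  enabled? C (s , e) = all? (λ q → all? λ q′ → (e q q′ ≟ᵇ true) →-dec (C q ≟ᵇ true))
                 ×-dec all? (λ q → (C q ≟ᵇ true) →-dec sat? s (e q) (δ q))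

  Enabled-resp : ∀ {C C′ x y} → C ≗ C′ → Setoid._≈_ (Moves m n) x y → Enabled C x → Enabled C′ y
  Enabled-resp C≗C′ (s≗s′ , e≗e′) (dom , sat) =
    (λ q q′ h → ≡.trans (≡.sym (C≗C′ q)) (dom q q′ (≡.trans (e≗e′ q q′) h))) ,
    (λ q h → Sat-mono (δ q) s≗s′ (λ q′ _ → ≡.trans (≡.sym (e≗e′ q q′)))
                      (sat q (≡.trans (C≗C′ q) h)))

  -- Lassos start from an arbitrary configuration C, so that moves can be prepended and dropped.
  record Lasso (C : SetOf n) (k : ℕ) : Set where
    constructor lasso
    field
      N       : ℕ
      moves   : ℕ → Move m n
      k≤N     : k ≤ N
      enabled : ∀ i → i ≤ N → Enabled (configFrom C moves i) (moves i)
      closes  : configFrom C moves k ≗ configFrom C moves (suc N)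
      covers  : ∀ q → F q ≡ true → ∃ λ j → k ≤ j × j ≤ N × proj₂ (moves j) q q ≡ false

  prepend : ∀ {C k x} → Enabled C x → Lasso (step C x) k → Lasso C (suc k)
  prepend {x = x} en (lasso N f k≤N enabled closes covers) =
    lasso (suc N) (x ◂ f) (s≤s k≤N) (λ { zero _ → en ; (suc i) (s≤s i≤N) → enabled i i≤N }) closes
          (λ q q∈F → let (j , k≤j , j≤N , miss) = covers q q∈F in suc j , s≤s k≤j , s≤s j≤N , miss)

  drop : ∀ {C k} (ℓ : Lasso C (suc k)) → Lasso (step C (Lasso.moves ℓ 0)) k
  drop {k = k} (lasso (suc N) f (s≤s k≤N) enabled closes covers) =
    lasso N (f ∘ suc) k≤N (λ i i≤N → enabled (suc i) (s≤s i≤N)) closes shift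
    where
    shift : ∀ q → F q ≡ true → ∃ λ j → k ≤ j × j ≤ N × proj₂ (f (suc j)) q q ≡ false
    shift q q∈F with covers q q∈F
    ... | suc j , s≤s k≤j , s≤s j≤N , miss = j , k≤j , j≤N , miss

  -- (current configuration, configuration to return to, locations of F whose self-loop was missed)
  LoopState : Set
  LoopState = SetOf n × SetOf n × SetOf n

  loopStep : LoopState → Move m n → LoopState
  loopStep (C , A , M) (s , e) = step C (s , e) , A , λ q → M q ∨ (F q ∧ not (e q q))

  Closed : Pred LoopState 0ℓ
  Closed (C , A , M) = C ≗ A × (∀ q → F q ≡ true → M q ≡ true)

  LoopStates : Setoid 0ℓ 0ℓ
  LoopStates = Sets n ×ₛ (Sets n ×ₛ Sets n)

  loopStep-cong : ∀ {v w x y} → Setoid._≈_ LoopStates v w → Setoid._≈_ (Moves m n) x y →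
                  Setoid._≈_ LoopStates (loopStep v x) (loopStep w y)
  loopStep-cong (C≗C′ , A≗A′ , M≗M′) x≈y@(_ , e≗e′) =
    step-cong C≗C′ x≈y , A≗A′ , λ q → cong₂ (λ a b → a ∨ (F q ∧ not b)) (M≗M′ q) (e≗e′ q q)

  closed? : Decidable Closed
  closed? (C , A , M) = all? (λ q → C q ≟ᵇ A q) ×-dec all? (λ q → (F q ≟ᵇ true) →-dec (M q ≟ᵇ true))

  Closed-resp : Closed Respects Setoid._≈_ LoopStates
  Closed-resp (C≗C′ , A≗A′ , M≗M′) (C≗A , F⊆M) =
    (λ q → ≡.trans (≡.sym (C≗C′ q)) (≡.trans (C≗A q) (A≗A′ q))) ,
    (λ q q∈F → ≡.trans (≡.sym (M≗M′ q)) (F⊆M q q∈F))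

  current-iterate : ∀ v f i → proj₁ (iterate loopStep v f i) ≡ configFrom (proj₁ v) f i
  current-iterate v f zero    = refl
  current-iterate v f (suc i) = current-iterate (loopStep v (f 0)) (f ∘ suc) i

  anchor-iterate : ∀ v f i → proj₁ (proj₂ (iterate loopStep v f i)) ≡ proj₁ (proj₂ v)
  anchor-iterate v f zero    = refl
  anchor-iterate v f (suc i) = anchor-iterate (loopStep v (f 0)) (f ∘ suc) i

  MissedWithin : LoopState → (ℕ → Move m n) → ℕ → Fin n → Set
  MissedWithin v f i q =
    proj₂ (proj₂ v) q ≡ true ⊎ (F q ≡ true × ∃ λ j → j < i × proj₂ (f j) q q ≡ false)

  missed-iterate : ∀ v f i q → proj₂ (proj₂ (iterate loopStep v f i)) q ≡ true ⇔ MissedWithin v f i q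
  missed-iterate v f zero    q = mk⇔ inj₁ [ id , (λ { (_ , _ , () , _) }) ]
  missed-iterate v f (suc i) q = mk⇔ to from
    where
    M : SetOf n
    M = proj₂ (proj₂ v)
    later : proj₂ (proj₂ (iterate loopStep v f (suc i))) q ≡ true ⇔
            MissedWithin (loopStep v (f 0)) (f ∘ suc) i q
    later = missed-iterate (loopStep v (f 0)) (f ∘ suc) i q
    first : M q ∨ (F q ∧ not (proj₂ (f 0) q q)) ≡ true ⇔
            (M q ≡ true ⊎ (F q ≡ true × proj₂ (f 0) q q ≡ false))
    first = ∨-∧-not-true (M q) (F q) (proj₂ (f 0) q q)
    to : proj₂ (proj₂ (iterate loopStep v f (suc i))) q ≡ true → MissedWithin v f (suc i) q
    to h with Equivalence.to later h
    ... | inj₂ (q∈F , j , j<i , miss) = inj₂ (q∈F , suc j , s<s j<i , miss)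
    ... | inj₁ h′ with Equivalence.to first h′
    ...   | inj₁ q∈M         = inj₁ q∈M
    ...   | inj₂ (q∈F , miss) = inj₂ (q∈F , 0 , z<s , miss)
    from : MissedWithin v f (suc i) q → proj₂ (proj₂ (iterate loopStep v f (suc i))) q ≡ true
    from (inj₁ q∈M)                            = Equivalence.from later (inj₁ (Equivalence.from first (inj₁ q∈M)))
    from (inj₂ (q∈F , zero , _ , miss))        =
      Equivalence.from later (inj₁ (Equivalence.from first (inj₂ (q∈F , miss))))
    from (inj₂ (q∈F , suc j , s<s j<i , miss)) = Equivalence.from later (inj₂ (q∈F , j , j<i , miss))

  module Loops = Reachability
    (×-finite (Sets-finite n) (×-finite (Sets-finite n) (Sets-finite n))) (Moves-finite m n)
    (λ v → Enabled (proj₁ v)) (λ v → enabled? (proj₁ v)) (λ v≈w → Enabled-resp (proj₁ v≈w))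
    loopStep loopStep-cong Closed closed? Closed-resp

  empty : SetOf n
  empty _ = false

  lasso⇒trail : ∀ {C} (ℓ : Lasso C 0) →
                Loops.Trail (suc (Lasso.N ℓ)) (C , C , empty) (Lasso.moves ℓ)
  lasso⇒trail {C} (lasso N f _ enabled closes covers) = enabled′ , closed
    where
    v : LoopState
    v = C , C , empty
    enabled′ : ∀ i → i < suc N → Enabled (proj₁ (iterate loopStep v f i)) (f i)
    enabled′ i i<1+N =
      subst (λ C′ → Enabled C′ (f i)) (≡.sym (current-iterate v f i)) (enabled i (≤-pred i<1+N))
    closed : Closed (iterate loopStep v f (suc N))
    closed = (λ q → ≡.trans (cong-app (current-iterate v f (suc N)) q)
                   (≡.trans (≡.sym (closes q)) (≡.sym (cong-app (anchor-iterate v f (suc N)) q))))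
           , λ q q∈F → let (j , _ , j≤N , miss) = covers q q∈F in
                       Equivalence.from (missed-iterate v f (suc N) q) (inj₂ (q∈F , j , s≤s j≤N , miss))

  trail⇒lasso : ∀ {C} L f → Loops.Trail (suc L) (C , C , empty) f → Lasso C 0
  trail⇒lasso {C} L f (enabled′ , current≗anchor , F⊆missed) = lasso L f z≤n enabled closes covers
    where
    v : LoopState
    v = C , C , empty
    enabled : ∀ i → i ≤ L → Enabled (configFrom C f i) (f i)
    enabled i i≤L = subst (λ C′ → Enabled C′ (f i)) (current-iterate v f i) (enabled′ i (s≤s i≤L))
    closes : C ≗ configFrom C f (suc L)
    closes q = ≡.trans (≡.sym (cong-app (anchor-iterate v f (suc L)) q))
                       (≡.trans (≡.sym (current≗anchor q)) (cong-app (current-iterate v f (suc L)) q))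
    covers : ∀ q → F q ≡ true → ∃ λ j → 0 ≤ j × j ≤ L × proj₂ (f j) q q ≡ false
    covers q q∈F with Equivalence.to (missed-iterate v f (suc L) q) (F⊆missed q q∈F)
    ... | inj₁ ()
    ... | inj₂ (_ , j , j<1+L , miss) = j , z≤n , ≤-pred j<1+L , miss

  HasCycle : Pred (SetOf n) 0ℓ
  HasCycle C = ∃ λ x → Enabled C x × Loops.Reachable (loopStep (C , C , empty) x)

  lasso⇒cycle : ∀ {C} → Lasso C 0 → HasCycle C
  lasso⇒cycle ℓ with Loops.step x en w ← Loops.trail⇒walk _ _ _ (lasso⇒trail ℓ) = x , en , _ , w

  cycle⇒lasso : ∀ {C} → HasCycle C → Lasso C 0
  cycle⇒lasso (x , en , L , w) with f , trail ← Loops.walk⇒trail x (Loops.step x en w) =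
    trail⇒lasso L f trail

  hasCycle? : Decidable HasCycle
  hasCycle? C = Finite.search (Moves-finite m n) resp
                  (λ x → enabled? C x ×-dec Loops.reachable? (loopStep (C , C , empty) x))
    where
    resp : (λ x → Enabled C x × Loops.Reachable (loopStep (C , C , empty) x))
             Respects Setoid._≈_ (Moves m n)
    resp x≈y (en , L , w) =
      Enabled-resp (λ _ → refl) x≈y en , L ,
      Loops.walk-resp (loopStep-cong ((λ _ → refl) , (λ _ → refl) , (λ _ → refl)) x≈y) w

  HasCycle-resp : HasCycle Respects _≗_
  HasCycle-resp C≗C′ (x , en , L , w) =
    x , Enabled-resp C≗C′ (Setoid.refl (Moves m n) {x}) en , L ,
    Loops.walk-resp (loopStep-cong (C≗C′ , C≗C′ , (λ _ → refl)) (Setoid.refl (Moves m n) {x})) w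

  module Prefixes = Reachability (Sets-finite n) (Moves-finite m n)
    Enabled enabled? Enabled-resp step step-cong HasCycle hasCycle? HasCycle-resp

  walk⇒lasso : ∀ {L C} → Prefixes.Walk L C → ∃ (Lasso C)
  walk⇒lasso (Prefixes.done cycle)   = 0 , cycle⇒lasso cycle
  walk⇒lasso (Prefixes.step x en w) with k , ℓ ← walk⇒lasso w = suc k , prepend en ℓ

  lasso⇒reachable : ∀ {C} k → Lasso C k → Prefixes.Reachable C
  lasso⇒reachable zero    ℓ = 0 , Prefixes.done (lasso⇒cycle ℓ)
  lasso⇒reachable (suc k) ℓ with L , w ← lasso⇒reachable k (drop ℓ) =
    suc L , Prefixes.step (Lasso.moves ℓ 0) (Lasso.enabled ℓ 0 z≤n) w

  lasso-stable : ∀ C → ¬ ¬ ∃ (Lasso C) → ∃ (Lasso C)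
  lasso-stable C ¬¬lasso
    with _ , w ← decidable-stable (Prefixes.reachable? C)
                                  (¬¬-map (λ (k , ℓ) → lasso⇒reachable k ℓ) ¬¬lasso) =
      walk⇒lasso w

  -- Lassos and run dags

  module Unrolling {k} (ℓ : Lasso initial k) where
    open Lasso ℓ

    successor : ℕ → ℕ
    successor j with j ≟ N
    ... | yes _ = k
    ... | no  _ = suc j

    index : ℕ → ℕ
    index zero    = zero
    index (suc i) = successor (index i)

    successor-< : ∀ {j} → j < N → successor j ≡ suc j
    successor-< {j} j<N with j ≟ N
    ... | yes j≡N = contradiction j≡N (<⇒≢ j<N)
    ... | no  _   = refl

    successor-N : successor N ≡ k
    successor-N with N ≟ N
    ... | yes _   = refl
    ... | no  N≢N = contradiction refl N≢N

    successor-≤ : ∀ {j} → j ≤ N → successor j ≤ N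
    successor-≤ {j} j≤N with j ≟ N
    ... | yes _   = k≤N
    ... | no  j≢N = ≤∧≢⇒< j≤N j≢N

    index≤N : ∀ i → index i ≤ N
    index≤N zero    = z≤n
    index≤N (suc i) = successor-≤ (index≤N i)

    index-+ : ∀ i d → index i + d ≤ N → index (i + d) ≡ index i + d
    index-+ i zero    _ = ≡.trans (cong index (+-identityʳ i)) (≡.sym (+-identityʳ (index i)))
    index-+ i (suc d) bound = begin
      index (i + suc d)         ≡⟨ cong index (+-suc i d) ⟩
      successor (index (i + d)) ≡⟨ cong successor (index-+ i d (<⇒≤ below)) ⟩
      successor (index i + d)   ≡⟨ successor-< below ⟩
      suc (index i + d)         ≡⟨ +-suc (index i) d ⟨
      index i + suc d           ∎
      where
      open ≡.≡-Reasoning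
      below : index i + d < N
      below = ≤-trans (≤-reflexive (≡.sym (+-suc (index i) d))) bound

    recurrent : ∀ j → k ≤ j → j ≤ N → ∀ i → ∃ λ i′ → i ≤ i′ × index i′ ≡ j
    recurrent j k≤j j≤N i =
      suc i₁ + (j ∸ k) , ≤-trans (m≤m+n i _) (≤-trans (n≤1+n i₁) (m≤m+n _ _)) , index-i₂
      where
      open ≡.≡-Reasoning
      i₁ : ℕ
      i₁ = i + (N ∸ index i)
      index-i₁ : index i₁ ≡ N
      index-i₁ = ≡.trans (index-+ i (N ∸ index i) (≤-reflexive reaches)) reaches
        where reaches = m+[n∸m]≡n (index≤N i)
      wraps : index (suc i₁) + (j ∸ k) ≡ j
      wraps = ≡.trans (cong (λ a → successor a + (j ∸ k)) index-i₁)
                      (≡.trans (cong (_+ (j ∸ k)) successor-N) (m+[n∸m]≡n k≤j))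
      index-i₂ : index (suc i₁ + (j ∸ k)) ≡ j
      index-i₂ = ≡.trans (index-+ (suc i₁) (j ∸ k) (≤-trans (≤-reflexive wraps) j≤N)) wraps

    word : Word m
    word i = proj₁ (moves (index i))

    edges : ℕ → Edges n
    edges i = proj₂ (moves (index i))

    configFrom-successor : ∀ {j} → j ≤ N →
                           configFrom initial moves (suc j) ≗ configFrom initial moves (successor j)
    configFrom-successor j≤N q with m≤n⇒m<n∨m≡n j≤N
    ... | inj₁ j<N rewrite successor-< j<N = refl
    ... | inj₂ refl rewrite successor-N    = ≡.sym (closes q)

    config-index : ∀ i → config q₀ edges i ≗ configFrom initial moves (index i)
    config-index zero    q = refl
    config-index (suc i) q =
      ≡.trans (img-cong {e = edges i} {e′ = edges i} (λ _ _ → refl) (config-index i) q)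
              (≡.trans (≡.sym (cong-app (iterate-suc step initial moves (index i)) q))
                       (configFrom-successor (index≤N i) q))

    run : IsRunDag aut word edges
    run i = Enabled-resp (≡.sym ∘ config-index i) (Setoid.refl (Moves m n) {moves (index i)})
                         (enabled (index i) (index≤N i))

    agrees : ∀ i → i ≤ N → (word i ≡ proj₁ (moves i)) × (edges i ≡ proj₂ (moves i))
    agrees i i≤N = cong (proj₁ ∘ moves) (index-+ 0 i i≤N) , cong (proj₂ ∘ moves) (index-+ 0 i i≤N)

    misses-loops : ∀ q → F q ≡ true → ∀ i → ∃ λ j → i ≤ j × edges j q q ≡ false
    misses-loops q q∈F i with j , k≤j , j≤N , miss ← covers q q∈F
                         with i′ , i≤i′ , index-i′ ← recurrent j k≤j j≤N i =
      i′ , i≤i′ , subst (λ t → proj₂ (moves t) q q ≡ false) (≡.sym index-i′) miss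

  LassoWitness : Set
  LassoWitness =
    Σ ℕ λ N → Σ (Word m) λ s → Σ (ℕ → Edges n) λ e →
      IsFiniteRunDag aut N s e ×
      (Σ ℕ λ k → k ≤ N ×
         (∀ q → config q₀ e k q ≡ config q₀ e (suc N) q) ×
         (∀ q → F q ≡ true → ∃ λ j → k ≤ j × j ≤ N × e j q q ≡ false))

  lasso⇒witness : ∀ {k} → Lasso initial k → LassoWitness
  lasso⇒witness {k} ℓ@(lasso N f k≤N _ closes covers) =
    N , proj₁ ∘ f , proj₂ ∘ f , (word , edges , run , agrees) , k , k≤N , closes′ , covers
    where
    open Unrolling ℓ
    closes′ : ∀ q → config q₀ (proj₂ ∘ f) k q ≡ config q₀ (proj₂ ∘ f) (suc N) q
    closes′ q = ≡.trans (cong-app (config≡configFrom f k) q)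
                        (≡.trans (closes q) (≡.sym (cong-app (config≡configFrom f (suc N)) q)))

  witness⇒lasso : LassoWitness → ∃ (Lasso initial)
  witness⇒lasso (N , s , e , (σ , Δ , run , agrees) , k , k≤N , closes , covers) =
    k , lasso N f k≤N enabled closes′ covers
    where
    f : ℕ → Move m n
    f i = s i , e i
    agree-config : ∀ i → i ≤ N → config q₀ Δ i ≡ config q₀ e i
    agree-config zero    _   = refl
    agree-config (suc i) i<N =
      cong₂ img (proj₂ (agrees i (<⇒≤ i<N))) (agree-config i (<⇒≤ i<N))
    enabled : ∀ i → i ≤ N → Enabled (configFrom initial f i) (f i)
    enabled i i≤N = subst₂ Enabled (≡.trans (agree-config i i≤N) (config≡configFrom f i))
                                   (cong₂ _,_ (proj₁ (agrees i i≤N)) (proj₂ (agrees i i≤N))) (run i)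
    closes′ : configFrom initial f k ≗ configFrom initial f (suc N)
    closes′ q = ≡.trans (≡.sym (cong-app (config≡configFrom f k) q))
                        (≡.trans (closes q) (cong-app (config≡configFrom f (suc N)) q))

  -- A run dag may use edges (q, q′) with q′ not in δ(q), along which paths can climb ≼.  Keeping only
  -- the edges along δ out of locations still reachable gives a run dag whose paths descend.
  module Pruning (σ : Word m) (Δ : ℕ → Edges n) (run : IsRunDag aut σ Δ) where

    pruned-config : ℕ → SetOf n
    pruned : ℕ → Edges n
    pruned i q q′ = pruned-config i q ∧ (Δ i q q′ ∧ ⌊ occurs? q′ (δ q) ⌋)
    pruned-config zero    = initial
    pruned-config (suc i) = img (pruned i) (pruned-config i)

    config-pruned : ∀ i → config q₀ pruned i ≡ pruned-config i
    config-pruned zero    = refl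
    config-pruned (suc i) = cong (img (pruned i)) (config-pruned i)

    pruned-edge : ∀ i q q′ → pruned i q q′ ≡ true →
                  pruned-config i q ≡ true × Δ i q q′ ≡ true × q ⟶ q′
    pruned-edge i q q′ h =
      ∧-conicalˡ (pruned-config i q) (Δ i q q′ ∧ occurs) h ,
      ∧-conicalˡ (Δ i q q′) occurs edge∧occurs ,
      toWitness (Equivalence.from T-≡ (∧-conicalʳ (Δ i q q′) occurs edge∧occurs))
      where
      occurs : Bool
      occurs = ⌊ occurs? q′ (δ q) ⌋
      edge∧occurs : Δ i q q′ ∧ occurs ≡ true
      edge∧occurs = ∧-conicalʳ (pruned-config i q) (Δ i q q′ ∧ occurs) h

    pruned-config⊆ : ∀ i q → pruned-config i q ≡ true → config q₀ Δ i q ≡ true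
    pruned-config⊆ zero    q h = h
    pruned-config⊆ (suc i) q h with r , r∈c , rq∈pruned ← img⁻ (pruned i) (pruned-config i) q h =
      img⁺ (Δ i) (config q₀ Δ i) (pruned-config⊆ i r r∈c) (proj₁ (proj₂ (pruned-edge i r q rq∈pruned)))

    pruned-run : IsRunDag aut σ pruned
    pruned-run i = dom , sat
      where
      dom : ∀ q q′ → pruned i q q′ ≡ true → config q₀ pruned i q ≡ true
      dom q q′ h = ≡.trans (cong-app (config-pruned i) q) (proj₁ (pruned-edge i q q′ h))
      sat : ∀ q → config q₀ pruned i q ≡ true → Sat (σ i) (pruned i q) (δ q)
      sat q h = Sat-mono (δ q) (λ _ → refl)
                  (λ q′ o qq′∈Δ →
                     cong₂ _∧_ q∈c (cong₂ _∧_ qq′∈Δ (Equivalence.to T-≡ (fromWitness o))))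
                  (proj₂ (run i) q (pruned-config⊆ i q q∈c))
        where
        q∈c : pruned-config i q ≡ true
        q∈c = ≡.trans (≡.sym (cong-app (config-pruned i) q)) h

    pruned-accepting : (∀ q → F q ≡ true → ∀ i → ∃ λ j → i ≤ j × Δ j q q ≡ false) →
                       IsAccepting aut (coBüchi F) pruned
    pruned-accepting misses p (_ , path) infinitely =
      no-infinite-descent linear-weak (p ∘ position) descending
      where
      edge : ∀ i → Δ i (p i) (p (suc i)) ≡ true
      edge i = proj₁ (proj₂ (pruned-edge i (p i) (p (suc i)) (path i)))

      occurs : ∀ i → p i ⟶ p (suc i)
      occurs i = proj₂ (proj₂ (pruned-edge i (p i) (p (suc i)) (path i)))

      descends : ∀ {i j} → i ≤′ j → Star _⟶_ (p i) (p j)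
      descends ≤′-refl              = ε
      descends (≤′-step {j} i≤′j) = descends i≤′j ◅◅ (occurs j ◅ ε)

      moves-after : ∀ t → ∃ λ t′ → t < t′ × p t′ ≢ p t
      moves-after t with i , t≤i , pᵢ∈F ← infinitely t with p i Fin.≟ p t
      ... | no pᵢ≢pₜ = i , ≤∧≢⇒< t≤i (λ { refl → pᵢ≢pₜ refl }) , pᵢ≢pₜ
      ... | yes pᵢ≡pₜ with j , i≤j , miss ← misses (p i) pᵢ∈F i with p j Fin.≟ p i
      ...   | no pⱼ≢pᵢ = j , ≤∧≢⇒< (≤-trans t≤i i≤j) (λ { refl → pⱼ≢pᵢ (≡.sym pᵢ≡pₜ) })
                       , λ pⱼ≡pₜ → pⱼ≢pᵢ (≡.trans pⱼ≡pₜ (≡.sym pᵢ≡pₜ))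
      ...   | yes pⱼ≡pᵢ = suc j , s≤s (≤-trans t≤i i≤j) , λ pⱼ₊₁≡pₜ →
        let loop = subst₂ (λ a b → Δ j a b ≡ true) pⱼ≡pᵢ (≡.trans pⱼ₊₁≡pₜ (≡.sym pᵢ≡pₜ)) (edge j)
        in contradiction (≡.trans (≡.sym loop) miss) λ ()

      position : ℕ → ℕ
      position zero    = zero
      position (suc r) = proj₁ (moves-after (position r))

      descending : ∀ r → Star _⟶_ (p (position r)) (p (position (suc r))) ×
                         p (position (suc r)) ≢ p (position r)
      descending r with t′ , t<t′ , moved ← moves-after (position r) =
        descends (≤⇒≤′ (<⇒≤ t<t′)) , moved

  lasso⇒nonempty : ∀ {k} → Lasso initial k → ∃ (ℒ 𝒜)
  lasso⇒nonempty ℓ = word , pruned , pruned-run , pruned-accepting misses-loops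
    where
    open Unrolling ℓ
    open Pruning word edges run

  module FromAcceptingRun (σ : Word m) (Δ : ℕ → Edges n) (run : IsRunDag aut σ Δ)
                          (accepting : IsAccepting aut (coBüchi F) Δ) where

    PathTo : ℕ → Fin n → Set
    PathTo k q = Σ (ℕ → Fin n) λ p →
      p 0 ≡ q₀ × (∀ i → i < k → Δ i (p i) (p (suc i)) ≡ true) × (∀ i → k ≤ i → p i ≡ q)

    path-to : ∀ k q → config q₀ Δ k q ≡ true → PathTo k q
    path-to zero q q∈c₀ = (λ _ → q) , toWitness (Equivalence.from T-≡ q∈c₀) , (λ _ ()) , (λ _ _ → refl)
    path-to (suc k) q q∈c
      with r , r∈c , rq∈Δ ← img⁻ (Δ k) (config q₀ Δ k) q q∈c
      with p , p₀ , steps , stays ← path-to k r r∈c =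
        splice k p q , ≡.trans (splice-≤ {k = k} p q z≤n) p₀ , steps′ , (λ _ k<i → splice-> p q k<i)
      where
      steps′ : ∀ i → i < suc k → Δ i (splice k p q i) (splice k p q (suc i)) ≡ true
      steps′ i i<1+k with m≤n⇒m<n∨m≡n (≤-pred i<1+k)
      ... | inj₁ i<k  rewrite splice-≤ p q (<⇒≤ i<k) | splice-≤ p q i<k = steps i i<k
      ... | inj₂ refl rewrite splice-≤ p q (≤-refl {i}) | splice-> p q (≤-refl {suc i})
                            | stays i ≤-refl = rq∈Δ

    -- Otherwise a path reaching q at time t could stay at q forever.
    missing-loop-ahead : ∀ q → F q ≡ true → ∀ t → ¬ ¬ ∃ λ j → t ≤ j × Δ j q q ≡ false
    missing-loop-ahead q q∈F t never-missed = stuck (path-to t q (proj₁ (run t) q q (loops t ≤-refl)))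
      where
      loops : ∀ j → t ≤ j → Δ j q q ≡ true
      loops j t≤j = ¬-not λ miss → never-missed (j , t≤j , miss)
      stuck : PathTo t q → ⊥
      stuck (p , p₀ , steps , stays) = accepting p (p₀ , path) infinitely
        where
        path : ∀ i → Δ i (p i) (p (suc i)) ≡ true
        path i with i <? t
        ... | yes i<t = steps i i<t
        ... | no  i≮t with t≤i ← ≮⇒≥ i≮t rewrite stays i t≤i | stays (suc i) (m≤n⇒m≤1+n t≤i) = loops i t≤i
        infinitely : InfinitelyMany (λ i → F (p i) ≡ true)
        infinitely i =
          i + t , m≤m+n i t , subst (λ r → F r ≡ true) (≡.sym (stays (i + t) (m≤n+m t i))) q∈F

    Covered : ℕ → ℕ → Set
    Covered t t′ = ∀ q → F q ≡ true → ∃ λ j → t ≤ j × j < t′ × Δ j q q ≡ false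

    Covered-mono : ∀ {t t′ t″} → Covered t t′ → t′ ≤ t″ → Covered t t″
    Covered-mono cov t′≤t″ q q∈F with j , t≤j , j<t′ , miss ← cov q q∈F =
      j , t≤j , <-≤-trans j<t′ t′≤t″ , miss

    window : ∀ t → ¬ ¬ ∃ λ t′ → t < t′ × Covered t t′
    window t = ¬¬-map bounded (¬¬-finite-bound P eventually)
      where
      P : Fin n → ℕ → Set
      P q j = t ≤ j × (F q ≡ true → Δ j q q ≡ false)
      eventually : ∀ q → ¬ ¬ ∃ (P q)
      eventually q with F q ≟ᵇ true
      ... | yes q∈F = ¬¬-map (λ (j , t≤j , miss) → j , t≤j , λ _ → miss) (missing-loop-ahead q q∈F t)
      ... | no  q∉F = contradiction (t , ≤-refl , λ q∈F → contradiction q∈F q∉F)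
      bounded : (∃ λ b → ∀ q → ∃ λ j → j < b × P q j) → ∃ λ t′ → t < t′ × Covered t t′
      bounded (b , below) = suc t ⊔ b , m≤m⊔n (suc t) b , λ q q∈F →
        let (j , j<b , t≤j , miss) = below q in j , t≤j , <-≤-trans j<b (m≤n⊔m (suc t) b) , miss q∈F

    Windows : ℕ → (ℕ → ℕ) → Set
    Windows r pos = ∀ {i j} → i < j → j ≤ r → pos i < pos j × Covered (pos i) (pos j)

    Windows-start : ∀ {r pos} → Windows r pos → ∀ j → j ≤ r → pos 0 ≤ pos j
    Windows-start W zero    _   = ≤-refl
    Windows-start W (suc j) j≤r = <⇒≤ (proj₁ (W z<s j≤r))

    windows : ∀ r t → ¬ ¬ ∃ λ pos → pos 0 ≡ t × Windows r pos
    windows zero    t = contradiction ((λ _ → t) , refl , λ { i<j z≤n → contradiction i<j λ () })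
    windows (suc r) t = do
      (t′ , t<t′ , cov) ← window t
      (pos , pos₀ , W) ← windows r t′
      pure (t ◂ pos , refl , λ {i} {j} → extend t<t′ cov pos₀ W {i} {j})
      where
      open RawMonad ¬¬-Monad
      extend : ∀ {t′ pos} → t < t′ → Covered t t′ → pos 0 ≡ t′ → Windows r pos →
               Windows (suc r) (t ◂ pos)
      extend {t′} {pos} t<t′ cov pos₀ W {zero} {suc j} _ (s≤s j≤r) =
        <-≤-trans t<t′ t′≤posⱼ , Covered-mono cov t′≤posⱼ
        where
        t′≤posⱼ : t′ ≤ pos j
        t′≤posⱼ = subst (_≤ pos j) pos₀ (Windows-start W j j≤r)
      extend t<t′ cov pos₀ W {suc i} {suc j} (s<s i<j) (s≤s j≤r) = W i<j j≤r

    lasso-between : ∀ {a b} → a < b → Covered a b → config q₀ Δ a ≗ config q₀ Δ b → Lasso initial a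
    lasso-between {a} {suc N} (s≤s a≤N) cov same = lasso N f a≤N enabled closes covers
      where
      f : ℕ → Move m n
      f i = σ i , Δ i
      enabled : ∀ i → i ≤ N → Enabled (configFrom initial f i) (f i)
      enabled i _ = subst (λ C → Enabled C (f i)) (config≡configFrom f i) (run i)
      closes : configFrom initial f a ≗ configFrom initial f (suc N)
      closes q = ≡.trans (≡.sym (cong-app (config≡configFrom f a) q))
                         (≡.trans (same q) (cong-app (config≡configFrom f (suc N)) q))
      covers : ∀ q → F q ≡ true → ∃ λ j → a ≤ j × j ≤ N × Δ j q q ≡ false
      covers q q∈F with j , a≤j , j<1+N , miss ← cov q q∈F = j , a≤j , ≤-pred j<1+N , miss

    ¬¬lasso : ¬ ¬ ∃ (Lasso initial)
    ¬¬lasso = ¬¬-map from-windows (windows (Finite.size (Sets-finite n)) 0)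
      where
      from-windows : (∃ λ pos → pos 0 ≡ 0 × Windows (Finite.size (Sets-finite n)) pos) →
                     ∃ (Lasso initial)
      from-windows (pos , _ , W)
        with i , j , i<j , same ←
               Finite.pigeonhole (Sets-finite n) (n<1+n _) (λ c → config q₀ Δ (pos (toℕ c)))
        with pos-i<pos-j , cov ← W i<j (toℕ≤pred[n] j) =
          pos (toℕ i) , lasso-between pos-i<pos-j cov same

  accepting⇒¬¬lasso : ∀ {σ} → ℒ 𝒜 σ → ¬ ¬ ∃ (Lasso initial)
  accepting⇒¬¬lasso (Δ , run , accepting) = FromAcceptingRun.¬¬lasso _ Δ run accepting

theorem1 : ∀ {m n} (𝒜 : LWAA m n) →
    (¬ (ℒ 𝒜 ≐ ∅)) ⇔
    (Σ ℕ λ N → Σ (Word m) λ s → Σ (ℕ → Edges n) λ e →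
       IsFiniteRunDag (LWAA.aut 𝒜) N s e ×
       (Σ ℕ λ k → k ≤ N ×
          (∀ q → config (LWAA.q₀ 𝒜) e k q ≡ config (LWAA.q₀ 𝒜) e (suc N) q) ×
          (∀ q → LWAA.F 𝒜 q ≡ true →
             ∃ λ j → k ≤ j × j ≤ N × e j q q ≡ false)))
theorem1 𝒜 = mk⇔ nonempty⇒witness witness⇒nonempty
  where
  nonempty⇒witness : ¬ (ℒ 𝒜 ≐ ∅) → LassoWitness 𝒜
  nonempty⇒witness nonempty =
    lasso⇒witness 𝒜 (proj₂ (lasso-stable 𝒜 (initial 𝒜) λ no-lasso →
      nonempty ((λ accepted → accepting⇒¬¬lasso 𝒜 accepted no-lasso) , λ ())))
  witness⇒nonempty : LassoWitness 𝒜 → ¬ (ℒ 𝒜 ≐ ∅)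
  witness⇒nonempty w (ℒ⊆∅ , _) = ℒ⊆∅ (proj₂ (lasso⇒nonempty 𝒜 (proj₂ (witness⇒lasso 𝒜 w))))
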